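{- $\mathbf{Fin}<Id<\mathbf{co}$ (strict learn-reducibility) and $\mathbf{Fin}\equiv_{\mathrm{fin}}Id\equiv_{\mathrm{fin}}\mathbf{co}$.
   Context: All structures are countable, have domain $\mathbb{N}$, finite relational signature, identified with atomic diagrams in $2^{\mathbb{N}}$. $\mathcal{S}\restriction_s$ is the finite substructure on $\{0,\dots,s\}$. A family of structures $\mathfrak{K}=\{\mathcal{A}_i\}$ is a countable set of pairwise nonisomorphic countable structures; $\mathrm{LD}(\mathfrak{K})$ = all structures isomorphic to a member of $\mathfrak{K}$; $\mathrm{HS}(\mathfrak{K})=\{\ulcorner\mathcal{A}\urcorner:\mathcal{A}\in\mathfrak{K}\}\cup\{?\}$. A learner is an arbitrary function from $\{\mathcal{S}\restriction_s:\mathcal{S}\in\mathrm{LD}(\mathfrak{K})\}$ to $\mathrm{HS}(\mathfrak{K})$. $\mathbf{Fin}$-learnable: some learner $\mathbf{M}$ satisfies, for all $\mathcal{S}\in\mathrm{LD}(\mathfrak{K})$, $\mathcal{A}\in\mathfrak{K}$, $\lim_n\mathbf{M}(\mathcal{S}\restriction_n)=\ulcorner\mathcal{A}\urcorner$ iff $\mathcal{S}\cong\mathcal{A}$, and the output is constant from the first stage where it differs from $?$. $\mathbf{co}$-learnable: some learner $\mathbf{M}$ satisfies, for all $\mathcal{S}\in\mathrm{LD}(\mathfrak{K})$ and $j$, $\{\mathbf{M}(\mathcal{S}\restriction_s):s\in\mathbb{N}\}=(\{\ulcorner\mathcal{A}_i\urcorner\}_i\cup\{?\})\setminus\{\ulcorner\mathcal{A}_j\urcorner\}$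 iff $\mathcal{S}\cong\mathcal{A}_j$. $Id$-learnable: there is a continuous $\Gamma:\mathrm{LD}(\mathfrak{K})\to\mathbb{N}^{\mathbb{N}}$ (Baire space) with $\mathcal{S}\cong\mathcal{S}'\iff\Gamma(\mathcal{S})=\Gamma(\mathcal{S}')$ for all $\mathcal{S},\mathcal{S}'\in\mathrm{LD}(\mathfrak{K})$. For learning criteria $X,Y$: $X\le Y$ means every $X$-learnable family is $Y$-learnable; $X\le_{\mathrm{fin}}Y$ means every finite $X$-learnable family is $Y$-learnable; $X<Y$ means $X\le Y$ and not $Y\le X$; $X\equiv_{\mathrm{fin}}Y$ means $X\le_{\mathrm{fin}}Y$ and $Y\le_{\mathrm{fin}}X$. -}

module Defs where

open import Data.Nat using (ℕ; zero; suc; _≤_)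
open import Data.Fin using (Fin)
open import Data.Vec using (Vec; []; _∷_; map)
open import Data.List as List using (List)
open import Data.Bool using (Bool)
open import Data.Maybe using (Maybe; just; nothing)
open import Data.Product using (Σ; ∃; _×_; _,_)
open import Data.Empty using (⊥)
open import Relation.Nullary using (¬_)
open import Relation.Binary.PropositionalEquality using (_≡_; _≢_)

record Sig : Set where
  field
    k  : ℕ
    ar : Fin k → ℕ
open Sig public

-- A structure with domain ℕ: its atomic diagram, given relation by relation
-- (equivalently an element of 2^ℕ via a fixed coding of atomic formulas).
Structure : Sig → Set
Structure σ = (r : Fin (k σ)) → Vec ℕ (ar σ r) → Bool

tuples : (a m : ℕ) → List (Vec ℕ a)
tuples zero    m = List.[ [] ]
tuples (suc a) m =
  List.concatMap (λ x → List.map (x ∷_) (tuples a m)) (List.upTo m)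

-- The finite substructure S↾s on {0,…,s}, as a first-order finite object:
-- the number s together with the truth values of all atomic facts
-- R(x̄) with x̄ ⊆ {0,…,s}.
FinCode : Set
FinCode = ℕ × List (List Bool)

restrict : {σ : Sig} → Structure σ → ℕ → FinCode
restrict {σ} S s =
  s , List.map (λ r → List.map (S r) (tuples (ar σ r) (suc s)))
               (List.allFin (k σ))

_≅_ : {σ : Sig} → Structure σ → Structure σ → Set
_≅_ {σ} S T =
  Σ (ℕ → ℕ) λ f → Σ (ℕ → ℕ) λ g →
    ((n : ℕ) → g (f n) ≡ n) × ((n : ℕ) → f (g n) ≡ n) ×
    ((r : Fin (k σ)) (v : Vec ℕ (ar σ r)) → S r v ≡ T r (map f v))

data Card : Set where
  fin : ℕ → Card
  ω   : Card

Idx : Card → Set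
Idx (fin n) = Fin n
Idx ω       = ℕ

record Family (σ : Sig) : Set where
  field
    card      : Card
    A         : Idx card → Structure σ
    pairwise  : (i j : Idx card) → A i ≅ A j → i ≡ j
open Family public

IsFinite : {σ : Sig} → Family σ → Set
IsFinite K = Σ ℕ λ n → card K ≡ fin n

InLD : {σ : Sig} → (K : Family σ) → Structure σ → Set
InLD K S = Σ (Idx (card K)) λ i → S ≅ A K i

-- HS(K): hypotheses; just i = ⌜A_i⌝, nothing = ?.
HS : {σ : Sig} → Family σ → Set
HS K = Maybe (Idx (card K))

-- Learner: arbitrary function from finite substructures to hypotheses
-- (defined on all codes; only values on codes S↾s with S ∈ LD(K) matter).
Learner : {σ : Sig} → Family σ → Set
Learner K = FinCode → HS K

Lim : {X : Set} → (ℕ → X) → X → Set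
Lim f x = Σ ℕ λ n₀ → (n : ℕ) → n₀ ≤ n → f n ≡ x

FinLearnable : {σ : Sig} → Family σ → Set
FinLearnable {σ} K =
  Σ (Learner K) λ M →
    (S : Structure σ) → InLD K S →
      ((i : Idx (card K)) →
          (Lim (λ n → M (restrict S n)) (just i) → S ≅ A K i) ×
          (S ≅ A K i → Lim (λ n → M (restrict S n)) (just i)))
      × ((n m : ℕ) → n ≤ m → M (restrict S n) ≢ nothing →
           M (restrict S m) ≡ M (restrict S n))

RangeIsAllBut : {σ : Sig} (K : Family σ) → Learner K → Structure σ →
                Idx (card K) → Set
RangeIsAllBut K M S j =
  (h : HS K) → ((Σ ℕ λ s → M (restrict S s) ≡ h) → h ≢ just j) ×
               (h ≢ just j → Σ ℕ λ s → M (restrict S s) ≡ h)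

CoLearnable : {σ : Sig} → Family σ → Set
CoLearnable {σ} K =
  Σ (Learner K) λ M →
    (S : Structure σ) → InLD K S → (j : Idx (card K)) →
      (RangeIsAllBut K M S j → S ≅ A K j) × (S ≅ A K j → RangeIsAllBut K M S j)

-- Γ : LD(K) → ℕ^ℕ continuous (w.r.t. the subspace topology from 2^ℕ):
-- each output value Γ(S)(n) is determined by some finite substructure S↾s.
Continuous : {σ : Sig} (K : Family σ) →
             ((S : Structure σ) → InLD K S → ℕ → ℕ) → Set
Continuous {σ} K Γ =
  (S : Structure σ) (p : InLD K S) (n : ℕ) → Σ ℕ λ s →
    (T : Structure σ) (q : InLD K T) → restrict T s ≡ restrict S s →
      Γ T q n ≡ Γ S p n

IdLearnable : {σ : Sig} → Family σ → Set
IdLearnable {σ} K =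
  Σ ((S : Structure σ) → InLD K S → ℕ → ℕ) λ Γ →
    Continuous K Γ ×
    ((S S' : Structure σ) (p : InLD K S) (p' : InLD K S') →
       (S ≅ S' → (n : ℕ) → Γ S p n ≡ Γ S' p' n) ×
       (((n : ℕ) → Γ S p n ≡ Γ S' p' n) → S ≅ S'))

Criterion : Set₁
Criterion = {σ : Sig} → Family σ → Set

_≤L_ : Criterion → Criterion → Set
X ≤L Y = (σ : Sig) (K : Family σ) → X K → Y K

_≤fin_ : Criterion → Criterion → Set
X ≤fin Y = (σ : Sig) (K : Family σ) → IsFinite K → X K → Y K

_<L_ : Criterion → Criterion → Set
X <L Y = (X ≤L Y) × ¬ (Y ≤L X)

_≡fin_ : Criterion → Criterion → Set
X ≡fin Y = (X ≤fin Y) × (Y ≤fin X)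

-- Give LD(K) the topology inherited from 2^ℕ. A family is Fin-learnable iff
-- every isomorphism class is open in LD(K), and co-learnable iff every class is
-- closed. Open classes make the index itself a continuous complete invariant,
-- and a continuous complete invariant that tells S apart from A i does so on a
-- finite piece of S, so Id-learnability sits in between. In a finite family the
-- complement of a class is a finite union of closed classes, so closed classes
-- are open and the three criteria coincide.
--
-- For strictness take successor chains with marked ends: the ray (origin
-- marked P), the coray, i.e. the reversed ray (origin marked Q), and the
-- segments 0 → ⋯ → n (0 marked P, n marked Q); any two of them are told apart
-- by an open invariant property "a point with P-value b reaches a point with
-- Q-value c in n steps".
-- In {ray} ∪ {segments} every class is closed and every segment class is open,
-- so recording which segment a structure is gives a continuous invariant; but
-- the ray is a limit of ever longer segments, so its class is not open. Adding
-- the reversed ray keeps all classes closed, but both rays are limits of the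
-- same segments, read from either end, so no continuous invariant separates
-- them.

module Submission where

open import Defs
open import Data.Product using (_×_; Σ; _,_; proj₁; proj₂; ∃)
open import Level using (0ℓ)
open import Axiom.ExcludedMiddle using (ExcludedMiddle)
open import Axiom.DoubleNegationElimination using (em⇒dne)
open import Data.Nat using (ℕ; zero; suc; _≤_; _<_; z≤n; s≤s; z<s; _⊔_; _+_; _∸_; _≟_; _<?_; _≤?_)
open import Data.Nat.Properties
open import Data.Fin as F using (Fin; toℕ; fromℕ<)
open import Data.Fin.Properties using (toℕ-injective; toℕ<n; fromℕ<-toℕ)
open import Data.Vec as V using (Vec; []; _∷_)
open import Data.Vec.Properties using (map-id; map-∘; map-cong)
open import Data.Vec.Relation.Unary.All as VAll using ([]; _∷_)
open import Data.List as L using (List)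
import Data.List.Properties as LP
import Data.List.Relation.Unary.All as LAll
open import Data.List.Relation.Unary.Any using (here; there)
import Data.List.Relation.Unary.Any as Any
open import Data.List.Membership.Propositional using (_∈_; find)
open import Data.List.Membership.Propositional.Properties
  using (∈-map⁺; ∈-map⁻; ∈-concatMap⁺; ∈-concatMap⁻; ∈-upTo⁺; ∈-upTo⁻; ∈-allFin)
open import Data.Bool using (Bool; true; false)
open import Data.Maybe as M using (Maybe; just; nothing)
open import Data.Maybe.Properties using (just-injective)
open import Data.Sum using (_⊎_; inj₁; inj₂)
open import Function using (id; _∘_; case_of_)
open import Function.Bundles using (_⇔_; mk⇔; Equivalence)
open import Relation.Nullary using (¬_; Dec; yes; no; does; contradiction)
open import Relation.Nullary.Decidable using (dec⇒maybe; _×-dec_; dec-true; dec-false; does-⇔; dec-yes)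
open import Relation.Binary.PropositionalEquality

module _ {σ : Sig} where

  ≅-refl : {S : Structure σ} → S ≅ S
  ≅-refl {S} = id , id , (λ _ → refl) , (λ _ → refl) , λ r v → cong (S r) (sym (map-id v))

  ≅-sym : {S T : Structure σ} → S ≅ T → T ≅ S
  ≅-sym {S} {T} (f , g , gf , fg , pres) = g , f , fg , gf , λ r v → begin
    T r v                     ≡⟨ cong (T r) (sym (map-inverse v)) ⟩
    T r (V.map f (V.map g v)) ≡⟨ sym (pres r (V.map g v)) ⟩
    S r (V.map g v)           ∎
    where
    open ≡-Reasoning
    map-inverse : ∀ {a} (v : Vec ℕ a) → V.map f (V.map g v) ≡ v
    map-inverse v = trans (sym (map-∘ f g v)) (trans (map-cong fg v) (map-id v))

  ≅-trans : {S T U : Structure σ} → S ≅ T → T ≅ U → S ≅ U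
  ≅-trans {U = U} (f , g , gf , fg , pres) (f′ , g′ , gf′ , fg′ , pres′) =
    f′ ∘ f , g ∘ g′ ,
    (λ n → trans (cong g (gf′ (f n))) (gf n)) ,
    (λ n → trans (cong f′ (fg (g′ n))) (fg′ n)) ,
    λ r v → trans (pres r v) (trans (pres′ r (V.map f v)) (cong (U r) (sym (map-∘ f′ f v))))

  ≅-through : {S T : Structure σ} (U : Structure σ) → S ≅ U → T ≅ U → S ≅ T
  ≅-through {T = T} U S≅U T≅U = ≅-trans {T = U} {U = T} S≅U (≅-sym T≅U)

AgreeBelow : {σ : Sig} → Structure σ → Structure σ → ℕ → Set
AgreeBelow {σ} S T m = (r : Fin (k σ)) (v : Vec ℕ (ar σ r)) → VAll.All (_< m) v → S r v ≡ T r v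

agreeBelow-mono : {σ : Sig} {S T : Structure σ} {m m′ : ℕ} → m′ ≤ m →
                  AgreeBelow S T m → AgreeBelow S T m′
agreeBelow-mono m′≤m agree r v v<m′ = agree r v (VAll.map (λ x<m′ → <-≤-trans x<m′ m′≤m) v<m′)

∈-tuples⁺ : ∀ {a m} {v : Vec ℕ a} → VAll.All (_< m) v → v ∈ tuples a m
∈-tuples⁺ [] = here refl
∈-tuples⁺ {suc a} {m} {x ∷ v} (x<m ∷ v<m) =
  ∈-concatMap⁺ (λ y → L.map (y ∷_) (tuples a m))
    (Any.map (λ { refl → ∈-map⁺ (x ∷_) (∈-tuples⁺ v<m) }) (∈-upTo⁺ x<m))

∈-tuples⁻ : ∀ {a m} {v : Vec ℕ a} → v ∈ tuples a m → VAll.All (_< m) v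
∈-tuples⁻ {zero} {v = []} _ = []
∈-tuples⁻ {suc a} {m} v∈
  with find (∈-concatMap⁻ (λ y → L.map (y ∷_) (tuples a m)) {xs = L.upTo m} v∈)
... | x , x∈ , v∈x∷ with ∈-map⁻ (x ∷_) v∈x∷
... | w , w∈ , refl = ∈-upTo⁻ x∈ ∷ ∈-tuples⁻ w∈

map-≡⇒≡-∈ : {A B : Set} {f g : A → B} {xs : List A} {x : A} →
            L.map f xs ≡ L.map g xs → x ∈ xs → f x ≡ g x
map-≡⇒≡-∈ {xs = _ L.∷ _} e (here refl) = LP.∷-injectiveˡ e
map-≡⇒≡-∈ {xs = _ L.∷ _} e (there x∈) = map-≡⇒≡-∈ (LP.∷-injectiveʳ e) x∈

module _ {σ : Sig} {S T : Structure σ} {s : ℕ} where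

  agree⇒restrict-≡ : AgreeBelow S T (suc s) → restrict S s ≡ restrict T s
  agree⇒restrict-≡ agree = cong (s ,_) (LP.map-cong (λ r →
    LP.map-cong-local (LAll.tabulate (λ v∈ → agree r _ (∈-tuples⁻ v∈)))) (L.allFin (k σ)))

  restrict-≡⇒agree : restrict S s ≡ restrict T s → AgreeBelow S T (suc s)
  restrict-≡⇒agree e r v v<1+s =
    map-≡⇒≡-∈ (map-≡⇒≡-∈ (cong proj₂ e) (∈-allFin r)) (∈-tuples⁺ v<1+s)

restrict-≡-mono : {σ : Sig} {S T : Structure σ} {s s′ : ℕ} → s′ ≤ s →
                  restrict S s ≡ restrict T s → restrict S s′ ≡ restrict T s′
restrict-≡-mono s′≤s e = agree⇒restrict-≡ (agreeBelow-mono (s≤s s′≤s) (restrict-≡⇒agree e))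

witnessIndex : {I : Set} {P : I → Set} → Dec (Σ I P) → Maybe I
witnessIndex = M.map proj₁ ∘ dec⇒maybe

witnessIndex-sound : {I : Set} {P : I → Set} (d : Dec (Σ I P)) {i : I} →
                     witnessIndex d ≡ just i → P i
witnessIndex-sound (yes (i , Pi)) refl = Pi

witnessIndex-unique : {I : Set} {P : I → Set} (d : Dec (Σ I P)) {i : I} →
                      P i → (∀ {j} → P j → j ≡ i) → witnessIndex d ≡ just i
witnessIndex-unique (yes (j , Pj)) _  unique = cong just (unique Pj)
witnessIndex-unique (no ∄)         Pi _      = contradiction (_ , Pi) ∄

encodeIdx : (c : Card) → Idx c → ℕ
encodeIdx (fin n) = toℕ
encodeIdx ω       = id

encodeIdx-injective : (c : Card) {i j : Idx c} → encodeIdx c i ≡ encodeIdx c j → i ≡ j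
encodeIdx-injective (fin n) = toℕ-injective
encodeIdx-injective ω       = id

decodeIdx : (c : Card) → ℕ → Maybe (Idx c)
decodeIdx (fin n) t = M.map (λ t<n → fromℕ< t<n) (dec⇒maybe (t <? n))
decodeIdx ω       t = just t

decodeIdx-encodeIdx : (c : Card) (i : Idx c) → decodeIdx c (encodeIdx c i) ≡ just i
decodeIdx-encodeIdx (fin n) i with dec-yes (toℕ i <? n) (toℕ<n i)
... | i<n , eq rewrite eq = cong just (fromℕ<-toℕ i i<n)
decodeIdx-encodeIdx ω       i = refl

diagonal-step : ℕ × ℕ → ℕ × ℕ
diagonal-step (zero  , b) = suc b , zero
diagonal-step (suc a , b) = a , suc b

cantor : ℕ → ℕ × ℕ
cantor zero    = 0 , 0
cantor (suc t) = diagonal-step (cantor t)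

proj₂-cantor-≤ : ∀ t → proj₂ (cantor t) ≤ t
proj₂-cantor-≤ zero = z≤n
proj₂-cantor-≤ (suc t) with cantor t | proj₂-cantor-≤ t
... | zero  , _ | _    = z≤n
... | suc _ , _ | b≤t = s≤s b≤t

cantor-onto-diagonal : ∀ n a b → a + b ≡ n → ∃ λ t → cantor t ≡ (a , b)
cantor-onto-diagonal zero    zero    zero    refl = 0 , refl
cantor-onto-diagonal (suc n) (suc a) zero    e
  with t , eq ← cantor-onto-diagonal n 0 a (suc-injective (trans (sym (+-identityʳ (suc a))) e))
  = suc t , cong diagonal-step eq
cantor-onto-diagonal n       a       (suc b) e
  with t , eq ← cantor-onto-diagonal n (suc a) b (trans (sym (+-suc a b)) e)
  = suc t , cong diagonal-step eq

schedule : (c : Card) → ℕ → Maybe (Idx c)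
schedule c t = decodeIdx c (proj₁ (cantor t))

schedule-often : (c : Card) (i : Idx c) (b : ℕ) → ∃ λ t → b ≤ t × schedule c t ≡ just i
schedule-often c i b with t , eq ← cantor-onto-diagonal _ (encodeIdx c i) b refl =
  t , subst (λ p → proj₂ p ≤ t) eq (proj₂-cantor-≤ t) ,
  trans (cong (decodeIdx c ∘ proj₁) eq) (decodeIdx-encodeIdx c i)

uniform-bound : {I : Set} (P : I → ℕ → Set) → (∀ x {s s′} → s ≤ s′ → P x s → P x s′) →
                (xs : List I) → (∀ x → ∃ (P x)) → ∃ λ s → ∀ {x} → x ∈ xs → P x s
uniform-bound P mono L.[]       each = 0 , λ ()
uniform-bound P mono (x L.∷ xs) each with each x | uniform-bound P mono xs each
... | s₀ , Px | s₁ , Pxs = s₀ ⊔ s₁ , λ where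
  (here refl) → mono x (m≤m⊔n s₀ s₁) Px
  (there x∈)  → mono _ (m≤n⊔m s₀ s₁) (Pxs x∈)

-- In the topology LD(K) inherits from 2^ℕ, a finite piece c forces (excludes)
-- index i when its basic neighbourhood lies inside (outside) the isomorphism
-- class of A i.
module _ {σ : Sig} (K : Family σ) where

  Forces : FinCode → Idx (card K) → Set
  Forces c i = (T : Structure σ) → InLD K T → restrict T (proj₁ c) ≡ c → T ≅ A K i

  Excludes : FinCode → Idx (card K) → Set
  Excludes c i = (T : Structure σ) → InLD K T → restrict T (proj₁ c) ≡ c → ¬ T ≅ A K i

  ClassOpen : Idx (card K) → Set
  ClassOpen i = (S : Structure σ) → S ≅ A K i → ∃ λ s → Forces (restrict S s) i

  ClassesOpen : Set
  ClassesOpen = ∀ i → ClassOpen i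

  ClassesClosed : Set
  ClassesClosed = (S : Structure σ) → InLD K S → ∀ i → ¬ S ≅ A K i →
                  ∃ λ s → Excludes (restrict S s) i

  ≅-index-unique : {S : Structure σ} {i j : Idx (card K)} → S ≅ A K i → S ≅ A K j → i ≡ j
  ≅-index-unique {j = j} S≅Ai S≅Aj = pairwise K _ _ (≅-trans {U = A K j} (≅-sym S≅Ai) S≅Aj)

  forces-mono : (S : Structure σ) {s m : ℕ} {i : Idx (card K)} → s ≤ m →
                Forces (restrict S s) i → Forces (restrict S m) i
  forces-mono S s≤m forced T T∈ e = forced T T∈ (restrict-≡-mono s≤m e)

  excludes-mono : (S : Structure σ) {s m : ℕ} {i : Idx (card K)} → s ≤ m →
                  Excludes (restrict S s) i → Excludes (restrict S m) i
  excludes-mono S s≤m excluded T T∈ e = excluded T T∈ (restrict-≡-mono s≤m e)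

fin⇒open : {σ : Sig} (K : Family σ) → FinLearnable K → ClassesOpen K
fin⇒open K (M , learns) i S S≅Ai with proj₂ (proj₁ (learns S (i , S≅Ai)) i) S≅Ai
... | n₀ , converges = n₀ , λ T T∈ e →
  proj₁ (proj₁ (learns T T∈) i) (committed T T∈ (trans (cong M e) (converges n₀ ≤-refl)))
  where
  committed : ∀ T → InLD K T → ∀ {n₀ i} → M (restrict T n₀) ≡ just i →
              Lim (λ n → M (restrict T n)) (just i)
  committed T T∈ {n₀} M≡i = n₀ , λ n n₀≤n →
    trans (proj₂ (learns T T∈) n₀ n n₀≤n λ M≡nothing → case trans (sym M≡i) M≡nothing of λ ()) M≡i

open⇒id : {σ : Sig} (K : Family σ) → ClassesOpen K → IdLearnable K
open⇒id {σ} K open-classes = Γ , continuous , Γ-≅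
  where
  code : Idx (card K) → ℕ
  code = encodeIdx (card K)
  Γ : (S : Structure σ) → InLD K S → ℕ → ℕ
  Γ S (i , _) _ = code i
  continuous : Continuous K Γ
  continuous S (i , S≅Ai) n with open-classes i S S≅Ai
  ... | s , forced = s , λ T (j , T≅Aj) e →
    cong code (≅-index-unique K T≅Aj (forced T (j , T≅Aj) e))
  Γ-≅ : (S S′ : Structure σ) (p : InLD K S) (p′ : InLD K S′) →
        (S ≅ S′ → ∀ n → Γ S p n ≡ Γ S′ p′ n) × ((∀ n → Γ S p n ≡ Γ S′ p′ n) → S ≅ S′)
  Γ-≅ S S′ (i , S≅Ai) (j , S′≅Aj) =
    (λ S≅S′ _ → cong code (≅-index-unique K (≅-trans {U = A K i} (≅-sym S≅S′) S≅Ai) S′≅Aj)) ,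
    λ same → ≅-through (A K i) S≅Ai
               (subst (λ l → S′ ≅ A K l) (sym (encodeIdx-injective (card K) (same 0))) S′≅Aj)

finite⇒listed : {σ : Sig} (K : Family σ) → IsFinite K →
                Σ (List (Idx (card K))) λ xs → ∀ i → i ∈ xs
finite⇒listed K (n , card≡n) =
  subst (λ c → Σ (List (Idx c)) λ xs → ∀ i → i ∈ xs) (sym card≡n) (L.allFin n , ∈-allFin)

co⇒closed : {σ : Sig} (K : Family σ) → CoLearnable K → ClassesClosed K
co⇒closed K (M , learns) S (j , S≅Aj) i S≇Ai
  with proj₂ (proj₂ (learns S (j , S≅Aj) j) S≅Aj (just i)) (λ { refl → S≇Ai S≅Aj })
... | t , M-S-t = t , λ T T∈ e T≅Ai →
  proj₁ (proj₂ (learns T T∈ i) T≅Ai (just i)) (t , trans (cong M e) M-S-t) refl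

record OpenProperty (σ : Sig) : Set₁ where
  field
    Holds       : Structure σ → Set
    Holds-≅     : {S T : Structure σ} → S ≅ T → Holds S → Holds T
    Holds-local : {S : Structure σ} → Holds S →
                  ∃ λ s → ∀ T → restrict T s ≡ restrict S s → Holds T
open OpenProperty

characterizes⇒open : {σ : Sig} (K : Family σ) (φ : OpenProperty σ) {i : Idx (card K)} →
                     Holds φ (A K i) → (∀ j → Holds φ (A K j) → j ≡ i) → ClassOpen K i
characterizes⇒open K φ φ-i only-i S S≅Ai with Holds-local φ (Holds-≅ φ (≅-sym S≅Ai) φ-i)
... | s , φ-near = s , λ T (j , T≅Aj) e →
  subst (λ l → T ≅ A K l) (only-i j (Holds-≅ φ T≅Aj (φ-near T e))) T≅Aj

ωFamily : {σ : Sig} (𝒜 : ℕ → Structure σ) → (∀ i j → 𝒜 i ≅ 𝒜 j → i ≡ j) → Family σ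
ωFamily 𝒜 pairwise = record { card = ω ; A = 𝒜 ; pairwise = pairwise }

Separates : {σ : Sig} → (ℕ → Structure σ) → Set₁
Separates {σ} 𝒜 = ∀ {i j} → i ≢ j →
                  Σ (OpenProperty σ) λ φ → Holds φ (𝒜 i) × ¬ Holds φ (𝒜 j)

module _ {σ : Sig} {𝒜 : ℕ → Structure σ} (separates : Separates 𝒜) where

  separates⇒pairwise : ∀ i j → 𝒜 i ≅ 𝒜 j → i ≡ j
  separates⇒pairwise i j 𝒜i≅𝒜j with i ≟ j
  ... | yes i≡j = i≡j
  ... | no  i≢j with separates i≢j
  ...   | φ , φ-i , ¬φ-j = contradiction (Holds-≅ φ 𝒜i≅𝒜j φ-i) ¬φ-j

  separates⇒closed : ClassesClosed (ωFamily 𝒜 separates⇒pairwise)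
  separates⇒closed S (j , S≅𝒜j) i S≇𝒜i with separates {j} {i} (λ { refl → S≇𝒜i S≅𝒜j })
  ... | φ , φ-j , ¬φ-i with Holds-local φ (Holds-≅ φ (≅-sym S≅𝒜j) φ-j)
  ...   | s , φ-near = s , λ T _ e T≅𝒜i → ¬φ-i (Holds-≅ φ T≅𝒜i (φ-near T e))

indicator : Bool → ℕ
indicator false = 0
indicator true  = 1

indicator-does≡1⇒ : {P : Set} (d : Dec P) → indicator (does d) ≡ 1 → P
indicator-does≡1⇒ (yes p) _ = p
indicator-does≡1⇒ (no _)  ()

module Classical (em : ExcludedMiddle 0ℓ) where

  ¬∀⇒∃≢ : {f g : ℕ → ℕ} → ¬ (∀ n → f n ≡ g n) → ∃ λ n → f n ≢ g n
  ¬∀⇒∃≢ ¬∀ = em⇒dne em λ ∄ → ¬∀ λ n → em⇒dne em (λ f≢g → ∄ (n , f≢g))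

  module _ {σ : Sig} (K : Family σ) where

    private
      Ix : Set
      Ix = Idx (card K)

    open⇒fin : ClassesOpen K → FinLearnable K
    open⇒fin open-classes =
      M , λ S S∈ → (λ i → converges⇒≅ S S∈ i , ≅⇒converges S S∈ i) , stable S S∈
      where
      M : Learner K
      M c = witnessIndex (em {Σ Ix (Forces K c)})

      forced⇒M : {S : Structure σ} → InLD K S → ∀ {s i} →
                 Forces K (restrict S s) i → M (restrict S s) ≡ just i
      forced⇒M {S} S∈ forced = witnessIndex-unique em forced
        λ forced′ → ≅-index-unique K (forced′ S S∈ refl) (forced S S∈ refl)

      converges⇒≅ : ∀ S → InLD K S → ∀ i → Lim (λ n → M (restrict S n)) (just i) → S ≅ A K i
      converges⇒≅ S S∈ i (n₀ , converges) = witnessIndex-sound em (converges n₀ ≤-refl) S S∈ refl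

      ≅⇒converges : ∀ S → InLD K S → ∀ i → S ≅ A K i → Lim (λ n → M (restrict S n)) (just i)
      ≅⇒converges S S∈ i S≅Ai with open-classes i S S≅Ai
      ... | s , forced = s , λ n s≤n → forced⇒M S∈ (forces-mono K S s≤n forced)

      stable : ∀ S → InLD K S → ∀ n m → n ≤ m →
               M (restrict S n) ≢ nothing → M (restrict S m) ≡ M (restrict S n)
      stable S S∈ n m n≤m M≢nothing with M (restrict S n) in eq
      ... | nothing = contradiction refl M≢nothing
      ... | just i  = forced⇒M S∈ (forces-mono K S n≤m (witnessIndex-sound em eq))

    id⇒closed : IdLearnable K → ClassesClosed K
    id⇒closed (Γ , continuous , Γ-≅) S S∈ i S≇Ai
      with ¬∀⇒∃≢ (λ same → S≇Ai (proj₂ (Γ-≅ S (A K i) S∈ (i , ≅-refl)) same))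
    ... | n , Γ-differ with continuous S S∈ n
    ... | s , Γ-local = s , λ T T∈ e T≅Ai →
      Γ-differ (trans (sym (Γ-local T T∈ e)) (proj₁ (Γ-≅ T (A K i) T∈ (i , ≅-refl)) T≅Ai n))

    closed⇒co : ClassesClosed K → CoLearnable K
    closed⇒co closed = M , λ S S∈ j → range⇒≅ S S∈ j , ≅⇒range S S∈ j
      where
      -- Stage 0 answers ? so that ? lies in every range.
      M : Learner K
      M (zero  , _)   = nothing
      M c@(suc t , _) = witnessIndex (em {Σ Ix λ i → schedule (card K) t ≡ just i × Excludes K c i})

      M-excludes : ∀ c {i} → M c ≡ just i → Excludes K c i
      M-excludes (suc t , _) e = proj₂ (witnessIndex-sound em e)

      excluded⇒M : ∀ S t {i} → schedule (card K) t ≡ just i → Excludes K (restrict S (suc t)) i →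
                   M (restrict S (suc t)) ≡ just i
      excluded⇒M S t scheduled excluded = witnessIndex-unique em (scheduled , excluded)
        λ (scheduled′ , _) → just-injective (trans (sym scheduled′) scheduled)

      ≅⇒range : ∀ S → InLD K S → ∀ j → S ≅ A K j → RangeIsAllBut K M S j
      ≅⇒range S S∈ j S≅Aj h =
        (λ { (s , e) refl → M-excludes (restrict S s) e S S∈ refl S≅Aj }) , hit h
        where
        hit : (h : HS K) → h ≢ just j → ∃ λ s → M (restrict S s) ≡ h
        hit nothing  _   = 0 , refl
        hit (just i) i≢j
          with closed S S∈ i (λ S≅Ai → i≢j (cong just (≅-index-unique K S≅Ai S≅Aj)))
        ... | s , excluded with schedule-often (card K) i s
        ... | t , s≤t , scheduled =
          suc t , excluded⇒M S t scheduled (excludes-mono K S (≤-trans s≤t (n≤1+n t)) excluded)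

      range⇒≅ : ∀ S → InLD K S → ∀ j → RangeIsAllBut K M S j → S ≅ A K j
      range⇒≅ S (k , S≅Ak) j range with em {k ≡ j}
      ... | yes refl = S≅Ak
      ... | no k≢j   = contradiction refl (proj₁ (range (just j))
                         (proj₂ (≅⇒range S (k , S≅Ak) k S≅Ak (just j)) (k≢j ∘ sym ∘ just-injective)))

    finite-closed⇒open : IsFinite K → ClassesClosed K → ClassesOpen K
    finite-closed⇒open finite closed i S S≅Ai = s , forced
      where
      Settled : Ix → ℕ → Set
      Settled j s = j ≡ i ⊎ Excludes K (restrict S s) j

      settled-mono : ∀ j {s s′} → s ≤ s′ → Settled j s → Settled j s′
      settled-mono _ _    (inj₁ j≡i)      = inj₁ j≡i
      settled-mono _ s≤s′ (inj₂ excluded) = inj₂ (excludes-mono K S s≤s′ excluded)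

      settle : ∀ j → ∃ (Settled j)
      settle j with em {j ≡ i}
      ... | yes j≡i = 0 , inj₁ j≡i
      ... | no  j≢i with closed S (i , S≅Ai) j (λ S≅Aj → j≢i (≅-index-unique K S≅Aj S≅Ai))
      ...   | s , excluded = s , inj₂ excluded

      all-settled : ∃ λ s → ∀ {j} → j ∈ proj₁ (finite⇒listed K finite) → Settled j s
      all-settled = uniform-bound Settled settled-mono (proj₁ (finite⇒listed K finite)) settle

      s : ℕ
      s = proj₁ all-settled

      forced : Forces K (restrict S s) i
      forced T (j , T≅Aj) e with proj₂ all-settled (proj₂ (finite⇒listed K finite) j)
      ... | inj₁ refl     = T≅Aj
      ... | inj₂ excluded = contradiction T≅Aj (excluded T (j , T≅Aj) e)

    Inseparable : Structure σ → Structure σ → Set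
    Inseparable S S′ = ∀ s s′ → Σ (Structure σ) λ T → Σ (Structure σ) λ T′ →
      InLD K T × InLD K T′ × T ≅ T′ ×
      restrict T s ≡ restrict S s × restrict T′ s′ ≡ restrict S′ s′

    inseparable⇒¬id : {S S′ : Structure σ} → InLD K S → InLD K S′ → ¬ S ≅ S′ →
                      Inseparable S S′ → ¬ IdLearnable K
    inseparable⇒¬id {S} {S′} S∈ S′∈ S≇S′ inseparable (Γ , continuous , Γ-≅)
      with ¬∀⇒∃≢ (λ same → S≇S′ (proj₂ (Γ-≅ S S′ S∈ S′∈) same))
    ... | n , Γ-differ with continuous S S∈ n | continuous S′ S′∈ n
    ... | s , Γ-local | s′ , Γ-local′ with inseparable s s′
    ... | T , T′ , T∈ , T′∈ , T≅T′ , T≈S , T′≈S′ = Γ-differ (begin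
      Γ S S∈ n     ≡⟨ sym (Γ-local T T∈ T≈S) ⟩
      Γ T T∈ n     ≡⟨ proj₁ (Γ-≅ T T′ T∈ T′∈) T≅T′ n ⟩
      Γ T′ T′∈ n   ≡⟨ Γ-local′ T′ T′∈ T′≈S′ ⟩
      Γ S′ S′∈ n   ∎)
      where open ≡-Reasoning

  module _ {σ : Sig} (𝒜 : ℕ → Structure σ) (pairwise : ∀ i j → 𝒜 i ≅ 𝒜 j → i ≡ j) where

    private
      K : Family σ
      K = ωFamily 𝒜 pairwise

    -- Γ S lists which of the open classes 1, 2, … contains S; the one
    -- class that need not be open is recognised by the answer "none".
    closed-open-off-zero⇒id : ClassesClosed K → (∀ i → ClassOpen K (suc i)) → IdLearnable K
    closed-open-off-zero⇒id closed open-suc = Γ , continuous , Γ-≅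
      where
      Γ : (S : Structure σ) → InLD K S → ℕ → ℕ
      Γ S _ m = indicator (does (em {S ≅ 𝒜 (suc m)}))

      continuous : Continuous K Γ
      continuous S S∈ m with em {S ≅ 𝒜 (suc m)}
      ... | yes S≅𝒜 with open-suc m S S≅𝒜
      ...   | s , forced = s , λ T T∈ e → cong indicator (dec-true em (forced T T∈ e))
      continuous S S∈ m | no S≇𝒜 with closed S S∈ (suc m) S≇𝒜
      ...   | s , excluded = s , λ T T∈ e → cong indicator (dec-false em (excluded T T∈ e))

      Γ≡1⇒≅ : ∀ S p m → Γ S p m ≡ 1 → S ≅ 𝒜 (suc m)
      Γ≡1⇒≅ S p m = indicator-does≡1⇒ em

      ≅⇒Γ≡1 : ∀ S p m → S ≅ 𝒜 (suc m) → Γ S p m ≡ 1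
      ≅⇒Γ≡1 S p m = cong indicator ∘ dec-true em

      Γ-≅ : (S S′ : Structure σ) (p : InLD K S) (p′ : InLD K S′) →
            (S ≅ S′ → ∀ n → Γ S p n ≡ Γ S′ p′ n) ×
            ((∀ n → Γ S p n ≡ Γ S′ p′ n) → S ≅ S′)
      Γ-≅ S S′ p p′ = (λ S≅S′ m → cong indicator (does-⇔ (≅-resp S≅S′) em em)) , same-Γ⇒≅ p p′
        where
        ≅-resp : ∀ {m} → S ≅ S′ → S ≅ 𝒜 (suc m) ⇔ S′ ≅ 𝒜 (suc m)
        ≅-resp {m} S≅S′ =
          mk⇔ (≅-trans {U = 𝒜 (suc m)} (≅-sym S≅S′)) (≅-trans {U = 𝒜 (suc m)} S≅S′)

        same-Γ⇒≅ : (p : InLD K S) (p′ : InLD K S′) → (∀ n → Γ S p n ≡ Γ S′ p′ n) → S ≅ S′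
        same-Γ⇒≅ (suc m , S≅𝒜) _ same =
          ≅-through (𝒜 (suc m)) S≅𝒜 (Γ≡1⇒≅ S′ p′ m (trans (sym (same m)) (≅⇒Γ≡1 S p m S≅𝒜)))
        same-Γ⇒≅ (zero , _) (suc m , S′≅𝒜) same =
          ≅-through (𝒜 (suc m)) (Γ≡1⇒≅ S p m (trans (same m) (≅⇒Γ≡1 S′ p′ m S′≅𝒜))) S′≅𝒜
        same-Γ⇒≅ (zero , S≅𝒜₀) (zero , S′≅𝒜₀) _ = ≅-through (𝒜 zero) S≅𝒜₀ S′≅𝒜₀

σ₀ : Sig
σ₀ = record { k = 3 ; ar = λ { F.zero → 2 ; (F.suc _) → 1 } }

graph : (ℕ → ℕ → Bool) → (ℕ → Bool) → (ℕ → Bool) → Structure σ₀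
graph e p q F.zero                 (x ∷ y ∷ []) = e x y
graph e p q (F.suc F.zero)         (x ∷ [])     = p x
graph e p q (F.suc (F.suc F.zero)) (x ∷ [])     = q x

E : Structure σ₀ → ℕ → ℕ → Bool
E S x y = S F.zero (x ∷ y ∷ [])

P Q : Structure σ₀ → ℕ → Bool
P S x = S (F.suc F.zero) (x ∷ [])
Q S x = S (F.suc (F.suc F.zero)) (x ∷ [])

ray : Structure σ₀
ray = graph (λ x y → does (y ≟ suc x)) (λ x → does (x ≟ 0)) (λ _ → false)

coray : Structure σ₀
coray = graph (λ x y → does (x ≟ suc y)) (λ _ → false) (λ x → does (x ≟ 0))

segment : ℕ → Structure σ₀
segment n = graph (λ x y → does (y ≟ suc x ×-dec x <? n)) (λ x → does (x ≟ 0)) (λ x → does (x ≟ n))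

Walk : Structure σ₀ → ℕ → ℕ → ℕ → Set
Walk S zero    x y = x ≡ y
Walk S (suc n) x y = Σ ℕ λ z → E S x z ≡ true × Walk S n z y

walk-≅ : {S T : Structure σ₀} (S≅T : S ≅ T) → ∀ {n x y} →
         Walk S n x y → Walk T n (proj₁ S≅T x) (proj₁ S≅T y)
walk-≅ (f , _ , _ , _ , pres) {zero}  x≡y             = cong f x≡y
walk-≅ S≅T@(f , _ , _ , _ , pres) {suc n} {x} (z , Exz , walk) =
  f z , trans (sym (pres F.zero (x ∷ z ∷ []))) Exz , walk-≅ S≅T walk

walk-local : {S : Structure σ₀} → ∀ {n x y} → Walk S n x y →
             ∃ λ m → x < m × y < m × ∀ {T} → AgreeBelow T S m → Walk T n x y
walk-local {n = zero} {x} refl = suc x , ≤-refl , ≤-refl , λ _ → refl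
walk-local {n = suc n} {x} (z , Exz , walk) with walk-local walk
... | m , z<m , y<m , walk-near = suc x ⊔ m , x<bound , <-≤-trans y<m m≤bound , λ agree →
  z , trans (agree F.zero (x ∷ z ∷ []) (x<bound ∷ <-≤-trans z<m m≤bound ∷ [])) Exz ,
  walk-near (agreeBelow-mono m≤bound agree)
  where
  x<bound : x < suc x ⊔ m
  x<bound = m≤m⊔n (suc x) m
  m≤bound : m ≤ suc x ⊔ m
  m≤bound = m≤n⊔m (suc x) m

Linked : ℕ → Bool → Bool → Structure σ₀ → Set
Linked n b c S = Σ ℕ λ x → Σ ℕ λ y → Walk S n x y × P S x ≡ b × Q S y ≡ c

linked : ℕ → Bool → Bool → OpenProperty σ₀
linked n b c = record { Holds = Linked n b c ; Holds-≅ = linked-≅ ; Holds-local = linked-local }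
  where
  linked-≅ : {S T : Structure σ₀} → S ≅ T → Linked n b c S → Linked n b c T
  linked-≅ S≅T@(f , _ , _ , _ , pres) (x , y , walk , Px , Qy) =
    f x , f y , walk-≅ S≅T walk ,
    trans (sym (pres (F.suc F.zero) (x ∷ []))) Px , trans (sym (pres (F.suc (F.suc F.zero)) (y ∷ []))) Qy

  linked-local : {S : Structure σ₀} → Linked n b c S →
                 ∃ λ s → ∀ T → restrict T s ≡ restrict S s → Linked n b c T
  linked-local (x , y , walk , Px , Qy) with walk-local walk
  ... | m , x<m , y<m , walk-near = m , λ T e →
    let agree = restrict-≡⇒agree e
    in x , y , walk-near (agreeBelow-mono (n≤1+n m) agree) ,
       trans (agree (F.suc F.zero) (x ∷ []) (m<n⇒m<1+n x<m ∷ [])) Px ,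
       trans (agree (F.suc (F.suc F.zero)) (y ∷ []) (m<n⇒m<1+n y<m ∷ [])) Qy

does≡true⇒ : {P : Set} (d : Dec P) → does d ≡ true → P
does≡true⇒ (yes p) _ = p

Successive : Structure σ₀ → Set
Successive S = ∀ {x y} → E S x y ≡ true → y ≡ suc x

walk-successive : {S : Structure σ₀} → Successive S → ∀ {n x y} → Walk S n x y → y ≡ n + x
walk-successive succ {zero}      refl              = refl
walk-successive succ {suc n} {x} (z , Exz , walk) = begin
  _          ≡⟨ walk-successive succ walk ⟩
  n + z      ≡⟨ cong (n +_) (succ Exz) ⟩
  n + suc x  ≡⟨ +-suc n x ⟩
  suc n + x  ∎
  where open ≡-Reasoning

segment-successive : ∀ {n} → Successive (segment n)
segment-successive {n} {x} {y} = proj₁ ∘ does≡true⇒ (y ≟ suc x ×-dec x <? n)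

ray-walk : ∀ i j → Walk ray j i (j + i)
ray-walk i zero    = refl
ray-walk i (suc j) =
  suc i , dec-true (suc i ≟ suc i) refl , subst (Walk ray j (suc i)) (+-suc j i) (ray-walk (suc i) j)

coray-walk : ∀ y j → Walk coray j (j + y) y
coray-walk y zero    = refl
coray-walk y (suc j) = j + y , dec-true (suc (j + y) ≟ suc (j + y)) refl , coray-walk y j

segment-walk : ∀ {n} i j → j + i ≤ n → Walk (segment n) j i (j + i)
segment-walk i zero    _       = refl
segment-walk {n} i (suc j) j+i<n =
  suc i , dec-true (suc i ≟ suc i ×-dec i <? n) (refl , <-≤-trans (s≤s (m≤n+m i j)) j+i<n) ,
  subst (Walk (segment n) j (suc i)) (+-suc j i)
    (segment-walk (suc i) j (subst (_≤ n) (sym (+-suc j i)) j+i<n))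

ray-linked : ∀ {n} → Linked n true false ray
ray-linked {n} = 0 , n + 0 , ray-walk 0 n , refl , refl

coray-linked : ∀ {n} → Linked n false true coray
coray-linked {n} = n + 0 , 0 , coray-walk 0 n , refl , refl

segment-linked : ∀ {n} → Linked n true true (segment n)
segment-linked {n} = 0 , n + 0 , segment-walk 0 n (≤-reflexive (+-identityʳ n)) , refl ,
                     dec-true (n + 0 ≟ n) (+-identityʳ n)

ray-¬linked-to-Q : ∀ {n b} → ¬ Linked n b true ray
ray-¬linked-to-Q (_ , _ , _ , _ , ())

coray-¬linked-from-P : ∀ {n c} → ¬ Linked n true c coray
coray-¬linked-from-P (_ , _ , _ , () , _)

-- In segment m the only P-point is 0, the only Q-point is m, and walks go up.
segment-linked⇒≡ : ∀ {m n} → Linked n true true (segment m) → n ≡ m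
segment-linked⇒≡ {m} {n} (x , y , walk , Px , Qy)
  with refl ← does≡true⇒ (x ≟ 0) Px | refl ← does≡true⇒ (y ≟ m) Qy =
  trans (sym (+-identityʳ n)) (sym (walk-successive (segment-successive {m}) walk))

segment-¬linked-to-¬Q : ∀ {n} → ¬ Linked n true false (segment n)
segment-¬linked-to-¬Q {n} (x , y , walk , Px , Qy) = case trans (sym (dec-true (y ≟ n) y≡n)) Qy of λ ()
  where
  y≡n : y ≡ n
  y≡n = begin
    y      ≡⟨ walk-successive (segment-successive {n}) walk ⟩
    n + x  ≡⟨ cong (n +_) (does≡true⇒ (x ≟ 0) Px) ⟩
    n + 0  ≡⟨ +-identityʳ n ⟩
    n      ∎
    where open ≡-Reasoning

segment-¬linked-from-¬P : ∀ {n} → ¬ Linked n false true (segment n)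
segment-¬linked-from-¬P {n} (x , y , walk , Px , Qy) = case trans (sym (dec-true (x ≟ 0) x≡0)) Px of λ ()
  where
  x≡0 : x ≡ 0
  x≡0 = +-cancelˡ-≡ n x 0 (begin
    n + x  ≡⟨ sym (walk-successive (segment-successive {n}) walk) ⟩
    y      ≡⟨ does≡true⇒ (y ≟ n) Qy ⟩
    n      ≡⟨ sym (+-identityʳ n) ⟩
    n + 0  ∎)
    where open ≡-Reasoning

segment-agrees-ray : ∀ n → AgreeBelow (segment n) ray n
segment-agrees-ray n F.zero (x ∷ y ∷ []) (x<n ∷ _ ∷ []) =
  does-⇔ (mk⇔ proj₁ (_, x<n)) (y ≟ suc x ×-dec x <? n) (y ≟ suc x)
segment-agrees-ray n (F.suc F.zero)         (x ∷ []) _          = refl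
segment-agrees-ray n (F.suc (F.suc F.zero)) (x ∷ []) (x<n ∷ []) = dec-false (x ≟ n) (<⇒≢ x<n)

reflect : ℕ → ℕ → ℕ
reflect n x with x ≤? n
... | yes _ = n ∸ x
... | no  _ = x

reflect-≤ : ∀ {n x} → x ≤ n → reflect n x ≡ n ∸ x
reflect-≤ {n} {x} x≤n with x ≤? n
... | yes _   = refl
... | no  x≰n = contradiction x≤n x≰n

reflect-involutive : ∀ n x → reflect n (reflect n x) ≡ x
reflect-involutive n x with x ≤? n
... | yes x≤n = trans (reflect-≤ (m∸n≤m n x)) (m∸[m∸n]≡n x≤n)
... | no  x≰n with x ≤? n
...   | yes x≤n = contradiction x≤n x≰n
...   | no  _   = refl

reflectedSegment : ℕ → Structure σ₀
reflectedSegment n r v = segment n r (V.map (reflect n) v)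

reflectedSegment≅segment : ∀ n → reflectedSegment n ≅ segment n
reflectedSegment≅segment n =
  reflect n , reflect n , reflect-involutive n , reflect-involutive n , λ _ _ → refl

-- Both sides are read off n = (n ∸ x) + x = (n ∸ y) + y.
∸-reflects-suc : ∀ {n x y} → x ≤ n → y ≤ n → n ∸ y ≡ suc (n ∸ x) ⇔ x ≡ suc y
∸-reflects-suc {n} {x} {y} x≤n y≤n = mk⇔
  (λ e → +-cancelˡ-≡ (n ∸ x) x (suc y) (begin
    (n ∸ x) + x      ≡⟨ m∸n+n≡m x≤n ⟩
    n                ≡⟨ sym (m∸n+n≡m y≤n) ⟩
    (n ∸ y) + y      ≡⟨ cong (_+ y) e ⟩
    suc (n ∸ x) + y  ≡⟨ sym (+-suc (n ∸ x) y) ⟩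
    (n ∸ x) + suc y  ∎))
  (λ { refl → +-cancelʳ-≡ y (n ∸ y) (suc (n ∸ x)) (begin
    (n ∸ y) + y      ≡⟨ m∸n+n≡m y≤n ⟩
    n                ≡⟨ sym (m∸n+n≡m x≤n) ⟩
    (n ∸ x) + suc y  ≡⟨ +-suc (n ∸ x) y ⟩
    suc (n ∸ x) + y  ∎) })
  where open ≡-Reasoning

reflectedSegment-agrees-coray : ∀ n → AgreeBelow (reflectedSegment n) coray n
reflectedSegment-agrees-coray n F.zero (x ∷ y ∷ []) (x<n ∷ y<n ∷ [])
  rewrite reflect-≤ (<⇒≤ x<n) | reflect-≤ (<⇒≤ y<n) =
  does-⇔ (mk⇔ (Equivalence.to reflects ∘ proj₁)
               λ x≡1+y → Equivalence.from reflects x≡1+y , n∸x<n x≡1+y)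
         (n ∸ y ≟ suc (n ∸ x) ×-dec n ∸ x <? n) (x ≟ suc y)
  where
  reflects = ∸-reflects-suc (<⇒≤ x<n) (<⇒≤ y<n)
  n∸x<n : x ≡ suc y → n ∸ x < n
  n∸x<n refl = ∸-monoʳ-< {n} {x} {0} z<s (<⇒≤ x<n)
reflectedSegment-agrees-coray n (F.suc F.zero) (x ∷ []) (x<n ∷ [])
  rewrite reflect-≤ (<⇒≤ x<n) = dec-false (n ∸ x ≟ 0) (m>n⇒m∸n≢0 x<n)
reflectedSegment-agrees-coray n (F.suc (F.suc F.zero)) (x ∷ []) (x<n ∷ [])
  rewrite reflect-≤ (<⇒≤ x<n) =
  does-⇔ (mk⇔ (∸-cancelˡ-≡ (<⇒≤ x<n) z≤n) λ { refl → refl }) (n ∸ x ≟ n) (x ≟ 0)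

distinguished-by-link : ∀ {n b c} {S T : Structure σ₀} → Linked n b c S → ¬ Linked n b c T →
                        Σ (OpenProperty σ₀) λ φ → Holds φ S × ¬ Holds φ T
distinguished-by-link {n} {b} {c} linked-S ¬linked-T = linked n b c , linked-S , ¬linked-T

𝒜₁ : ℕ → Structure σ₀
𝒜₁ zero    = ray
𝒜₁ (suc n) = segment n

separates-𝒜₁ : Separates 𝒜₁
separates-𝒜₁ {zero}  {zero}  0≢0 = contradiction refl 0≢0
separates-𝒜₁ {zero}  {suc n} _   = distinguished-by-link ray-linked segment-¬linked-to-¬Q
separates-𝒜₁ {suc n} {zero}  _   = distinguished-by-link segment-linked ray-¬linked-to-Q
separates-𝒜₁ {suc n} {suc m} n≢m =
  distinguished-by-link segment-linked λ linked → n≢m (cong suc (segment-linked⇒≡ linked))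

K₁ : Family σ₀
K₁ = ωFamily 𝒜₁ (separates⇒pairwise separates-𝒜₁)

segment-classes-open : ∀ n → ClassOpen K₁ (suc n)
segment-classes-open n = characterizes⇒open K₁ (linked n true true) segment-linked only-suc-n
  where
  only-suc-n : ∀ j → Linked n true true (𝒜₁ j) → j ≡ suc n
  only-suc-n zero    linked = contradiction linked ray-¬linked-to-Q
  only-suc-n (suc m) linked = cong suc (sym (segment-linked⇒≡ linked))

ray-class-not-open : ¬ ClassOpen K₁ 0
ray-class-not-open ray-open with ray-open ray ≅-refl
... | s , forced
  with forced (segment (suc s)) (suc (suc s) , ≅-refl) (agree⇒restrict-≡ (segment-agrees-ray (suc s)))
...   | segment≅ray with () ← separates⇒pairwise separates-𝒜₁ (suc (suc s)) 0 segment≅ray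

K₁-¬fin : ¬ FinLearnable K₁
K₁-¬fin learnable = ray-class-not-open (fin⇒open K₁ learnable 0)

K₁-id : ExcludedMiddle 0ℓ → IdLearnable K₁
K₁-id em = closed-open-off-zero⇒id 𝒜₁ (separates⇒pairwise separates-𝒜₁)
             (separates⇒closed separates-𝒜₁) segment-classes-open
  where open Classical em

𝒜₂ : ℕ → Structure σ₀
𝒜₂ zero          = ray
𝒜₂ (suc zero)    = coray
𝒜₂ (suc (suc n)) = segment n

separates-𝒜₂ : Separates 𝒜₂
separates-𝒜₂ {zero}        {zero}        0≢0 = contradiction refl 0≢0
separates-𝒜₂ {zero}        {suc zero}    _   = distinguished-by-link (ray-linked {0}) coray-¬linked-from-P
separates-𝒜₂ {zero}        {suc (suc n)} _   = distinguished-by-link ray-linked segment-¬linked-to-¬Q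
separates-𝒜₂ {suc zero}    {zero}        _   = distinguished-by-link (coray-linked {0}) ray-¬linked-to-Q
separates-𝒜₂ {suc zero}    {suc zero}    1≢1 = contradiction refl 1≢1
separates-𝒜₂ {suc zero}    {suc (suc n)} _   = distinguished-by-link coray-linked segment-¬linked-from-¬P
separates-𝒜₂ {suc (suc n)} {zero}        _   = distinguished-by-link segment-linked ray-¬linked-to-Q
separates-𝒜₂ {suc (suc n)} {suc zero}    _   = distinguished-by-link segment-linked coray-¬linked-from-P
separates-𝒜₂ {suc (suc n)} {suc (suc m)} n≢m =
  distinguished-by-link segment-linked λ linked → n≢m (cong (suc ∘ suc) (segment-linked⇒≡ linked))

K₂ : Family σ₀
K₂ = ωFamily 𝒜₂ (separates⇒pairwise separates-𝒜₂)

K₂-co : ExcludedMiddle 0ℓ → CoLearnable K₂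
K₂-co em = closed⇒co K₂ (separates⇒closed separates-𝒜₂)
  where open Classical em

K₂-¬id : ExcludedMiddle 0ℓ → ¬ IdLearnable K₂
K₂-¬id em = inseparable⇒¬id K₂ {ray} {coray} (0 , ≅-refl) (1 , ≅-refl) ray≇coray λ s s′ →
  let n = suc (s + s′) in
  segment n , reflectedSegment n , (suc (suc n) , ≅-refl) , (suc (suc n) , reflectedSegment≅segment n) ,
  ≅-sym (reflectedSegment≅segment n) ,
  agree⇒restrict-≡ (agreeBelow-mono (s≤s (m≤m+n s s′)) (segment-agrees-ray n)) ,
  agree⇒restrict-≡ (agreeBelow-mono (s≤s (m≤n+m s′ s)) (reflectedSegment-agrees-coray n))
  where
  open Classical em
  ray≇coray : ¬ ray ≅ coray
  ray≇coray ray≅coray with () ← separates⇒pairwise separates-𝒜₂ 0 1 ray≅coray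

mainTheorem8 : ExcludedMiddle 0ℓ →
    ((FinLearnable <L IdLearnable) × (IdLearnable <L CoLearnable)) ×
    ((FinLearnable ≡fin IdLearnable) × (IdLearnable ≡fin CoLearnable))
mainTheorem8 em =
  ((fin≤id , λ id≤fin → K₁-¬fin (id≤fin σ₀ K₁ (K₁-id em))) ,
   (id≤co  , λ co≤id  → K₂-¬id em (co≤id σ₀ K₂ (K₂-co em)))) ,
  (((λ σ K _ → fin≤id σ K) , id≤fin-on-finite) , ((λ σ K _ → id≤co σ K) , co≤id-on-finite))
  where
  open Classical em

  fin≤id : FinLearnable ≤L IdLearnable
  fin≤id σ K = open⇒id K ∘ fin⇒open K

  id≤co : IdLearnable ≤L CoLearnable
  id≤co σ K = closed⇒co K ∘ id⇒closed K

  id≤fin-on-finite : IdLearnable ≤fin FinLearnable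
  id≤fin-on-finite σ K finite = open⇒fin K ∘ finite-closed⇒open K finite ∘ id⇒closed K

  co≤id-on-finite : CoLearnable ≤fin IdLearnable
  co≤id-on-finite σ K finite = open⇒id K ∘ finite-closed⇒open K finite ∘ co⇒closed K
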